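{- Let $n\ge 2$ be a power of $2$ and let $i \in [\log_2 n]$. A pair $x < y$ of elements of $\{0,1,\dots,n-1\}$ forms a $(1,2)$-copy in $f_i$ (i.e., $f_i(x)<f_i(y)$) if and only if $M(x,y) = i$.
   Context: Identify the domain with $\{0,1,\dots,n-1\}$. Every $t$ in it has a unique binary representation $(b^t_1,\dots,b^t_{\log_2 n})\in\{0,1\}^{\log_2 n}$ with $t=\sum_{j=1}^{\log_2 n} b^t_j 2^{j-1}$. For $i\in[\log_2 n]$, the bit-flip operator $F_i$ maps $t$ to the number whose representation is obtained by flipping the $i$-th bit $b^t_i$. For distinct $x,y$, $M(x,y)$ is the largest index $i$ with $b^x_i\ne b^y_i$. Let $f^{\downarrow}(x)=n+1-x$ (strictly decreasing) and $f_i=f^{\downarrow}\circ F_i$, i.e., $f_i(x)=f^{\downarrow}(F_i(x))$. -}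

module Defs where

open import Data.Nat using (ℕ; zero; suc; _+_; _∸_; _^_; _/_; _%_; _≡ᵇ_)
open import Data.Bool using (if_then_else_)
open import Data.Nat.Properties using (m^n≢0)

-- The j-th bit (1-indexed) of t:  b^t_j = ⌊t / 2^(j-1)⌋ mod 2,
-- so that t = Σ_j b^t_j 2^(j-1).  Only used for j ≥ 1.
bit : ℕ → ℕ → ℕ
bit t zero    = 0
bit t (suc j) = ((t / (2 ^ j)) {{m^n≢0 2 j}}) % 2

F : ℕ → ℕ → ℕ
F zero    t = t
F (suc i) t = if bit t (suc i) ≡ᵇ 0 then t + 2 ^ i else t ∸ 2 ^ i

-- M(x,y) with bit-length k: the largest index i ∈ {1,…,k} with b^x_i ≠ b^y_i
-- (searched from k downwards; returns 0 if none, which never happens for x ≠ y < 2^k).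
M : ℕ → ℕ → ℕ → ℕ
M zero    x y = 0
M (suc j) x y = if bit x (suc j) ≡ᵇ bit y (suc j) then M j x y else suc j

-- f↓(x) = n + 1 - x  (domain {0,…,n-1}, so no truncation occurs)
fdown : ℕ → ℕ → ℕ
fdown n x = n + 1 ∸ x

f : ℕ → ℕ → ℕ → ℕ
f n i x = fdown n (F i x)

module Submission where

-- Split x around position i as x = A·2P + (b·P + r) with P = 2^j: the high part
-- A = ⌊x / 2^i⌋, the i-th bit b and the low part r < P.  Then F_i x is the same
-- split with b replaced by 1 ∸ b, and by place value the order of such numbers
-- is the lexicographic order of the triples (A, b, r).  A short case analysis
-- on lexicographic orders shows that, for x < y, flipping b reverses the order
-- exactly when A_x = A_y and b_x ≠ b_y; and this is precisely M(x, y) = i,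
-- because M scans the bits from the top down to the first difference.  Since
-- f↓ is strictly decreasing on {0,…,n}, a (1,2)-copy of f_i is an inversion of
-- F_i, which proves the lemma.

open import Defs
open import Data.Nat using (ℕ; _^_; _<_; _≤_)
open import Relation.Binary.PropositionalEquality using (_≡_)
open import Function.Bundles using (_⇔_)

open import Data.Nat using (zero; suc; _+_; _*_; _∸_; _/_; _%_; _≡ᵇ_; s≤s; NonZero; _≟_)
open import Data.Nat.Properties
open import Data.Nat.DivMod
open import Data.Nat.Solver using (module +-*-Solver)
open import Data.Bool using (true; false; if_then_else_)
open import Data.Unit using (tt)
open import Data.Empty using (⊥; ⊥-elim)
open import Data.Product using (_×_; _,_)
open import Data.Sum using (_⊎_; inj₁; inj₂)
open import Data.Sum.Function.Propositional using (_⊎-⇔_)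
open import Data.Product.Function.NonDependent.Propositional using (_×-⇔_)
open import Relation.Nullary using (yes; no)
open import Relation.Binary.PropositionalEquality using (refl; sym; trans; cong; cong₂; subst₂; _≢_; module ≡-Reasoning)
open import Relation.Binary.Definitions using (tri<; tri≈; tri>)
open import Function.Bundles using (mk⇔; Equivalence)
import Function.Properties.Equivalence as ⇔

open +-*-Solver using (solve; _:+_; _:*_; _:=_; con)

<-cong⇔ : ∀ {a a' b b'} → a ≡ a' → b ≡ b' → (a < b) ⇔ (a' < b')
<-cong⇔ refl refl = ⇔.refl

leading-digit-< : ∀ {P a b r s} → r < P → a < b → a * P + r < b * P + s
leading-digit-< {P} {a} {b} {r} {s} r<P a<b = begin-strict
  a * P + r  <⟨ +-monoʳ-< (a * P) r<P ⟩
  a * P + P  ≡⟨ +-comm (a * P) P ⟩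
  suc a * P  ≤⟨ *-monoˡ-≤ P a<b ⟩
  b * P      ≤⟨ m≤m+n (b * P) s ⟩
  b * P + s  ∎
  where open ≤-Reasoning

place-value-< : ∀ {P a b r s} → r < P → s < P →
                (a * P + r < b * P + s) ⇔ (a < b ⊎ (a ≡ b × r < s))
place-value-< {P} {a} {b} {r} {s} r<P s<P = mk⇔ to from
  where
  to : a * P + r < b * P + s → a < b ⊎ (a ≡ b × r < s)
  to h with <-cmp a b
  ... | tri< a<b _ _ = inj₁ a<b
  ... | tri≈ _ refl _ = inj₂ (refl , +-cancelˡ-< (a * P) r s h)
  ... | tri> _ _ b<a = ⊥-elim (<-asym h (leading-digit-< s<P b<a))
  from : a < b ⊎ (a ≡ b × r < s) → a * P + r < b * P + s
  from (inj₁ a<b) = leading-digit-< r<P a<b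
  from (inj₂ (refl , r<s)) = +-monoʳ-< (a * P) r<s

Lex : ℕ → ℕ → ℕ → ℕ → ℕ → ℕ → Set
Lex A b r A' b' r' = A < A' ⊎ (A ≡ A' × (b < b' ⊎ (b ≡ b' × r < r')))

Lex-asym : ∀ {A b r A' b' r'} → Lex A b r A' b' r' → Lex A' b' r' A b r → ⊥
Lex-asym (inj₁ p) (inj₁ q) = <-asym p q
Lex-asym (inj₁ p) (inj₂ (refl , _)) = <-irrefl refl p
Lex-asym (inj₂ (refl , _)) (inj₁ q) = <-irrefl refl q
Lex-asym (inj₂ (_ , inj₁ p)) (inj₂ (_ , inj₁ q)) = <-asym p q
Lex-asym (inj₂ (_ , inj₁ p)) (inj₂ (_ , inj₂ (refl , _))) = <-irrefl refl p
Lex-asym (inj₂ (_ , inj₂ (refl , _))) (inj₂ (_ , inj₁ q)) = <-irrefl refl q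
Lex-asym (inj₂ (_ , inj₂ (_ , p))) (inj₂ (_ , inj₂ (_ , q))) = <-asym p q

Lex-flip : ∀ {A b r A' b' r'} → b ≤ 1 → b' ≤ 1 → Lex A b r A' b' r' →
           Lex A' (1 ∸ b') r' A (1 ∸ b) r ⇔ (b ≢ b' × A ≡ A')
Lex-flip {A} {b} {r} {A'} {b'} {r'} b≤1 b'≤1 lex = mk⇔ to from
  where
  to : Lex A' (1 ∸ b') r' A (1 ∸ b) r → b ≢ b' × A ≡ A'
  to (inj₁ A'<A) = ⊥-elim (Lex-asym lex (inj₁ A'<A))
  to (inj₂ (A'≡A , inj₁ c'<c)) = (λ { refl → <-irrefl refl c'<c }) , sym A'≡A
  to (inj₂ (A'≡A , inj₂ (c'≡c , r'<r))) =
    ⊥-elim (Lex-asym lex (inj₂ (A'≡A , inj₂ (∸-cancelˡ-≡ b'≤1 b≤1 c'≡c , r'<r))))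
  from : b ≢ b' × A ≡ A' → Lex A' (1 ∸ b') r' A (1 ∸ b) r
  from (b≢b' , refl) = flipped lex
    where
    flipped : Lex A b r A b' r' → Lex A (1 ∸ b') r' A (1 ∸ b) r
    flipped (inj₁ A<A) = ⊥-elim (<-irrefl refl A<A)
    flipped (inj₂ (_ , inj₁ b<b')) = inj₂ (refl , inj₁ (∸-monoʳ-< b<b' b'≤1))
    flipped (inj₂ (_ , inj₂ (b≡b' , _))) = ⊥-elim (b≢b' b≡b')

split : ℕ → ℕ → ℕ → ℕ → ℕ
split P A b r = A * (2 * P) + (b * P + r)

lower-part-< : ∀ {P b r} → b < 2 → r < P → b * P + r < 2 * P
lower-part-< {P} {b} {r} b<2 r<P =
  subst₂ _<_ refl (+-identityʳ (2 * P)) (leading-digit-< {s = 0} r<P b<2)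

split-< : ∀ {P A b r A' b' r'} → b < 2 → b' < 2 → r < P → r' < P →
          (split P A b r < split P A' b' r') ⇔ Lex A b r A' b' r'
split-< b<2 b'<2 r<P r'<P =
  ⇔.trans (place-value-< (lower-part-< b<2 r<P) (lower-part-< b'<2 r'<P))
          (⇔.refl ⊎-⇔ (⇔.refl ×-⇔ place-value-< r<P r'<P))

high low : ℕ → ℕ → ℕ
high j x = (x / 2 ^ j) {{m^n≢0 2 j}}
low  j x = (x % 2 ^ j) {{m^n≢0 2 j}}

low< : ∀ j x → low j x < 2 ^ j
low< j x = m%n<n x (2 ^ j) {{m^n≢0 2 j}}

high-suc : ∀ j x → high (suc j) x ≡ high j x / 2
high-suc j x = sym (trans (m/n/o≡m/[n*o] x (2 ^ j) 2 {{m^n≢0 2 j}} {{_}} {{2^j*2≢0}})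
                          (/-congʳ {{2^j*2≢0}} {{m^n≢0 2 (suc j)}} (*-comm (2 ^ j) 2)))
  where
  2^j*2≢0 : NonZero (2 ^ j * 2)
  2^j*2≢0 = m*n≢0 (2 ^ j) 2 {{m^n≢0 2 j}}

high-split : ∀ j x → high j x ≡ bit x (suc j) + high (suc j) x * 2
high-split j x = trans (m≡m%n+[m/n]*n (high j x) 2)
                       (cong (λ h → bit x (suc j) + h * 2) (sym (high-suc j x)))

bit<2 : ∀ j x → bit x (suc j) < 2
bit<2 j x = m%n<n (high j x) 2

complement<2 : ∀ b → 1 ∸ b < 2
complement<2 b = s≤s (m∸n≤m 1 b)

split-of : ∀ j x → x ≡ split (2 ^ j) (high (suc j) x) (bit x (suc j)) (low j x)
split-of j x = begin
  x                              ≡⟨ m≡m%n+[m/n]*n x (2 ^ j) {{m^n≢0 2 j}} ⟩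
  low j x + high j x * 2 ^ j     ≡⟨ cong (λ h → low j x + h * 2 ^ j) (high-split j x) ⟩
  low j x + (b + A * 2) * 2 ^ j  ≡⟨ solve 4 (λ r b A P → r :+ (b :+ A :* con 2) :* P
                                                      := A :* (con 2 :* P) :+ (b :* P :+ r))
                                            refl (low j x) b A (2 ^ j) ⟩
  split (2 ^ j) A b (low j x)    ∎
  where
  open ≡-Reasoning
  A = high (suc j) x
  b = bit x (suc j)

complement-middle : ∀ P A b r → b < 2 →
  (if b ≡ᵇ 0 then split P A b r + P else split P A b r ∸ P) ≡ split P A (1 ∸ b) r
complement-middle P A zero r _ =
  solve 3 (λ A P r → A :* (con 2 :* P) :+ (con 0 :* P :+ r) :+ P
                   := A :* (con 2 :* P) :+ (con 1 :* P :+ r)) refl A P r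
complement-middle P A (suc zero) r _ =
  trans (cong (_∸ P) (solve 3 (λ A P r → A :* (con 2 :* P) :+ (con 1 :* P :+ r)
                                       := P :+ (A :* (con 2 :* P) :+ (con 0 :* P :+ r))) refl A P r))
        (m+n∸m≡n P (split P A 0 r))
complement-middle P A (suc (suc b)) r (s≤s (s≤s ()))

F-split : ∀ j x → F (suc j) x ≡ split (2 ^ j) (high (suc j) x) (1 ∸ bit x (suc j)) (low j x)
F-split j x =
  trans (cong (λ z → if bit x (suc j) ≡ᵇ 0 then z + 2 ^ j else z ∸ 2 ^ j) (split-of j x))
        (complement-middle (2 ^ j) (high (suc j) x) (bit x (suc j)) (low j x) (bit<2 j x))

F-inverts : ∀ j {x y} → x < y →
  (F (suc j) y < F (suc j) x) ⇔ (bit x (suc j) ≢ bit y (suc j) × high (suc j) x ≡ high (suc j) y)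
F-inverts j {x} {y} x<y =
  ⇔.trans (<-cong⇔ (F-split j y) (F-split j x))
  (⇔.trans (split-< (complement<2 (b y)) (complement<2 (b x)) (low< j y) (low< j x))
           (Lex-flip (bit≤1 x) (bit≤1 y) x<y-lex))
  where
  b : ℕ → ℕ
  b z = bit z (suc j)
  bit≤1 : ∀ z → b z ≤ 1
  bit≤1 z = <⇒≤pred (bit<2 j z)
  x<y-lex : Lex (high (suc j) x) (b x) (low j x) (high (suc j) y) (b y) (low j y)
  x<y-lex = Equivalence.to (split-< (bit<2 j x) (bit<2 j y) (low< j x) (low< j y))
                           (subst₂ _<_ (split-of j x) (split-of j y) x<y)

F-bound : ∀ d j {z} → z < 2 ^ (d + suc j) → F (suc j) z < 2 ^ (d + suc j)
F-bound d j {z} z<2ᵏ =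
  subst₂ _<_ (sym (F-split j z)) (trans (+-identityʳ _) (sym 2ᵏ≡))
    (leading-digit-< (lower-part-< (complement<2 (bit z (suc j))) (low< j z)) high<)
  where
  2ᵏ≡ : 2 ^ (d + suc j) ≡ 2 ^ d * 2 ^ suc j
  2ᵏ≡ = ^-distribˡ-+-* 2 d (suc j)
  high< : high (suc j) z < 2 ^ d
  high< = m<n*o⇒m/o<n {{m^n≢0 2 (suc j)}} (subst₂ _<_ refl 2ᵏ≡ z<2ᵏ)

if-≡ᵇ-same : ∀ {A : Set} {a b} {t e : A} → a ≡ b → (if a ≡ᵇ b then t else e) ≡ t
if-≡ᵇ-same {a = a} refl with a ≡ᵇ a | ≡⇒≡ᵇ a a refl
... | true | _ = refl

if-≡ᵇ-differ : ∀ {A : Set} {a b} {t e : A} → a ≢ b → (if a ≡ᵇ b then t else e) ≡ e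
if-≡ᵇ-differ {a = a} {b} a≢b with a ≡ᵇ b | ≡ᵇ⇒≡ a b
... | false | _ = refl
... | true | a≡b = ⊥-elim (a≢b (a≡b tt))

module _ {x y : ℕ} where

  high-agree-above : ∀ d m → high m x ≡ high m y → high (d + m) x ≡ high (d + m) y
  high-agree-above zero m h = h
  high-agree-above (suc d) m h =
    trans (high-suc (d + m) x) (trans (cong (_/ 2) (high-agree-above d m h)) (sym (high-suc (d + m) y)))

  high-agree-below : ∀ m → bit x (suc m) ≡ bit y (suc m) →
                     high (suc m) x ≡ high (suc m) y → high m x ≡ high m y
  high-agree-below m b≡ h≡ =
    trans (high-split m x) (trans (cong₂ (λ b h → b + h * 2) b≡ h≡) (sym (high-split m y)))

  M-skip : ∀ d m → high m x ≡ high m y → M (d + m) x y ≡ M m x y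
  M-skip zero m h = refl
  M-skip (suc d) m h =
    trans (if-≡ᵇ-same (cong (_% 2) (high-agree-above d m h))) (M-skip d m h)

  M-stop : ∀ k j → high k x ≡ high k y → M k x y ≡ suc j →
           bit x (suc j) ≢ bit y (suc j) × high (suc j) x ≡ high (suc j) y
  M-stop zero j h ()
  M-stop (suc k) j h M≡ with bit x (suc k) ≟ bit y (suc k)
  ... | yes b≡ = M-stop k j (high-agree-below k b≡ h) (trans (sym (if-≡ᵇ-same b≡)) M≡)
  ... | no b≢ with trans (sym (if-≡ᵇ-differ b≢)) M≡
  ...   | refl = b≢ , h

  M-char : ∀ d j → x < 2 ^ (d + suc j) → y < 2 ^ (d + suc j) →
           (M (d + suc j) x y ≡ suc j) ⇔ (bit x (suc j) ≢ bit y (suc j) × high (suc j) x ≡ high (suc j) y)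
  M-char d j x<2ᵏ y<2ᵏ = mk⇔ (M-stop (d + suc j) j top-agree) from
    where
    top-agree : high (d + suc j) x ≡ high (d + suc j) y
    top-agree = trans (m<n⇒m/n≡0 {{2ᵏ≢0}} x<2ᵏ) (sym (m<n⇒m/n≡0 {{2ᵏ≢0}} y<2ᵏ))
      where
      2ᵏ≢0 : NonZero (2 ^ (d + suc j))
      2ᵏ≢0 = m^n≢0 2 (d + suc j)
    from : bit x (suc j) ≢ bit y (suc j) × high (suc j) x ≡ high (suc j) y → M (d + suc j) x y ≡ suc j
    from (b≢ , h) = trans (M-skip d (suc j) h) (if-≡ᵇ-differ b≢)

fdown-reverses : ∀ {N a b} → a ≤ N → (fdown N a < fdown N b) ⇔ (b < a)
fdown-reverses {N} {a} {b} a≤N = mk⇔ to from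
  where
  to : N + 1 ∸ a < N + 1 ∸ b → b < a
  to h with <-cmp b a
  ... | tri< b<a _ _ = b<a
  ... | tri≈ _ refl _ = ⊥-elim (<-irrefl refl h)
  ... | tri> _ _ a<b = ⊥-elim (<⇒≱ h (∸-monoʳ-≤ (N + 1) (<⇒≤ a<b)))
  from : b < a → N + 1 ∸ a < N + 1 ∸ b
  from b<a = ∸-monoʳ-< b<a (≤-trans a≤N (m≤m+n N 1))

lemma4p3 : (k : ℕ) → 1 ≤ k → (i : ℕ) → 1 ≤ i → i ≤ k →
           (x y : ℕ) → x < y → y < 2 ^ k →
           (f (2 ^ k) i x < f (2 ^ k) i y) ⇔ (M k x y ≡ i)
-- Write i = j+1 and k = d + i; then chain the reversal by f↓, the inversion
-- criterion for F_i and the characterisation of M.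
lemma4p3 k _ (suc j) _ i≤k x y x<y y<2ᵏ with k ∸ suc j | m∸n+n≡m i≤k
... | d | refl =
  ⇔.trans (fdown-reverses (<⇒≤ (F-bound d j x<2ᵏ)))
  (⇔.trans (F-inverts j x<y)
           (⇔.sym (M-char d j x<2ᵏ y<2ᵏ)))
  where
  x<2ᵏ : x < 2 ^ (d + suc j)
  x<2ᵏ = <-trans x<y y<2ᵏ
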